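{- Let $\mathcal{F}$ be a financial network in which every bank uses an edge-ranking rule. Then $\mathcal{F}$ admits no positive debt swap, i.e., there are no two edges $e_1=(u_1,v_1)$, $e_2=(u_2,v_2)$ whose debt swap $\sigma$ satisfies both $a^\sigma_{v_1}>a_{v_1}$ and $a^\sigma_{v_2}>a_{v_2}$.
   Context: A financial network $\mathcal{F}=(G,\mathbf{l},\mathbf{a}^x,\mathbf{f})$ consists of a finite directed graph $G=(V,E)$ without loops or parallel edges (nodes are banks), a liability $l_e\in\mathbb{N}_{>0}$ for each edge $e=(u,w)$ (bank $u$ owes bank $w$ the amount $l_e$), external assets $a^x_v\in\mathbb{N}$ for each bank $v$, and an allocation rule $\mathbf{f}$ assigning to every outgoing edge $e\in E^+(v)$ of bank $v$ a payment function $f_e:\mathbb{R}_{\ge 0}\to[0,l_e]$ which is continuous and non-decreasing, such that $\sum_{e\in E^+(v)}f_e(b)=\min\{b,L_v\}$ for all $b\ge0$, where $L_v=\sum_{e\in E^+(v)}l_e$. $E^-(v)$ denotes the incoming edges of $v$. A vector $(b_v)_{v\in V}\ge 0$ is feasible if $b_v=a^x_v+\sum_{e=(u,v)\in E^-(v)}f_e(b_u)$ for all $v$; the feasible vectors form a complete lattice, and the clearing state consists of the pointwise maximal feasible vector $(a_v)_{v\in V}$ (the total assets) and the payments $p_e=f_e(a_u)$ for $e=(u,w)$. In an edge-ranking rule, each bank $v$ has a linear order $\pi_v(1),\pi_v(2),\dots$ of $E^+(v)$ and pays its available assets to these edges in this order, paying each edge fully before paying the next one, until its assets are exhausted or all edges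 are fully paid. A debt swap $\sigma$ of two edges $e_1=(u_1,v_1)$, $e_2=(u_2,v_2)$ with $l_{e_1}=l_{e_2}$ and $u_1,v_1,u_2,v_2$ pairwise distinct yields the network $\mathcal{F}^\sigma$ obtained by removing $e_1,e_2$ and adding $(u_1,v_2)$ and $(u_2,v_1)$, both with liability $l_{e_1}$, where $(u_1,v_2)$ takes over the payment function of $e_1$ (in particular its position in $u_1$'s ranking) and $(u_2,v_1)$ takes over that of $e_2$; all else is unchanged. $v_1,v_2$ are the creditors of the swap; $a_w$ and $a^\sigma_w$ denote total assets in the clearing states of $\mathcal{F}$ and $\mathcal{F}^\sigma$. A swap is positive if $a^\sigma_{v_1}>a_{v_1}$ and $a^\sigma_{v_2}>a_{v_2}$.
   Formalization: Feasible vectors and the total assets $a_w$, $a^\sigma_w$ of the clearing states take values in ℚ rather than ℝ, and the payment functions are taken over ℚ. -}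

module Defs where

open import Data.Nat using (ℕ; zero; suc) renaming (_<_ to _<ℕ_)
open import Data.Fin using (Fin; zero; suc)
open import Data.Product using (_×_; _,_; Σ)
open import Data.Empty using (⊥)
open import Relation.Nullary using (¬_; Dec; yes; no)
open import Relation.Binary.PropositionalEquality using (_≡_; _≢_)
open import Data.Fin using (_≟_)
open import Data.Integer using (+_)
open import Data.Rational using (ℚ; 0ℚ; _+_; _-_; _⊓_; _⊔_; _≤_; _<_; _/_)
import Data.Nat as ℕ

toℚ : ℕ → ℚ
toℚ k = (+ k) / 1

∑ : (m : ℕ) → (Fin m → ℚ) → ℚ
∑ zero    g = 0ℚ
∑ (suc m) g = g zero + ∑ m (λ i → g (suc i))

-- A financial network on banks Fin n with edges Fin m (given as an edge list),
-- in which every bank uses an edge-ranking rule: rank e is the position of edge e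
-- in the ranking of its source bank src e (smaller rank = paid earlier).
record Network (n m : ℕ) : Set where
  field
    src  : Fin m → Fin n            -- debtor u of edge e = (u , w)
    tgt  : Fin m → Fin n            -- creditor w of edge e = (u , w)
    liab : Fin m → ℕ
    ext  : Fin n → ℕ
    rank : Fin m → ℕ
open Network public

record WellFormed {n m : ℕ} (F : Network n m) : Set where
  field
    noLoop     : ∀ e → src F e ≢ tgt F e
    noParallel : ∀ e e' → src F e ≡ src F e' → tgt F e ≡ tgt F e' → e ≡ e'
    liabPos    : ∀ e → 0 <ℕ liab F e
    rankInj    : ∀ e e' → src F e ≡ src F e' → rank F e ≡ rank F e' → e ≡ e'

if-dec : {P : Set} → Dec P → ℚ → ℚ
if-dec (yes _) q = q
if-dec (no _)  _ = 0ℚ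

before : {n m : ℕ} → Network n m → Fin m → ℚ
before {m = m} F e =
  ∑ m (λ e' → if-dec (src F e' ≟ src F e)
                (if-dec (rank F e' ℕ.<? rank F e) (toℚ (liab F e'))))

pay : {n m : ℕ} → Network n m → Fin m → ℚ → ℚ
pay F e b = toℚ (liab F e) ⊓ (0ℚ ⊔ (b - before F e))

Feasible : {n m : ℕ} → Network n m → (Fin n → ℚ) → Set
Feasible {n} {m} F b =
  (∀ v → 0ℚ ≤ b v) ×
  (∀ v → b v ≡ toℚ (ext F v) +
           ∑ m (λ e → if-dec (tgt F e ≟ v) (pay F e (b (src F e)))))

Clearing : {n m : ℕ} → Network n m → (Fin n → ℚ) → Set
Clearing F a = Feasible F a × (∀ b → Feasible F b → ∀ v → b v ≤ a v)

-- debt swap of e1 = (u1,v1) and e2 = (u2,v2): e1 becomes (u1,v2), e2 becomes (u2,v1);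
-- each keeps its liability and its position in the debtor's ranking.
swap : {n m : ℕ} → Network n m → Fin m → Fin m → Network n m
swap F e1 e2 = record
  { src  = src F
  ; tgt  = λ e → newTgt e (e ≟ e1) (e ≟ e2)
  ; liab = liab F
  ; ext  = ext F
  ; rank = rank F
  }
  where
  newTgt : ∀ e → Dec (e ≡ e1) → Dec (e ≡ e2) → _
  newTgt e (yes _) _       = tgt F e2
  newTgt e (no _)  (yes _) = tgt F e1
  newTgt e (no _)  (no _)  = tgt F e

{-# OPTIONS --safe #-}
-- Let D be the set of banks whose assets strictly increase under the swap.  Both creditors lie in
-- D, so the swap does not change which edges point into D.  Conservation of money then forces every
-- bank of D to have a partially paid edge (the point where its ranking is cut off) leading into D.
-- Following such edges from a bank of D eventually runs into a cycle, and pushing a small amount of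
-- money around that cycle gives a feasible asset vector above the clearing vector, contradicting
-- its maximality.
module Submission where

open import Defs
open import Data.Nat as ℕ using (ℕ; zero; suc)
import Data.Nat.Properties as ℕ
open import Data.Fin using (Fin; zero; suc; _≟_; toℕ)
open import Data.Fin.Properties using (suc-injective; any?; pigeonhole)
open import Data.Maybe using (Maybe; just; nothing)
open import Data.Rational
  using (ℚ; 0ℚ; 1ℚ; _+_; _-_; -_; _*_; _⊓_; _⊔_; _≤_; _<_; 1/_; NonZero; positive; nonNegative)
open import Data.Rational.Properties hiding (_≟_)
open import Data.Rational.Solver using (module +-*-Solver)
open import Data.Product using (_×_; _,_; proj₁; proj₂; ∃; ∃₂)
open import Data.Sum using (_⊎_; inj₁; inj₂)
open import Data.Empty using (⊥; ⊥-elim)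
open import Function using (_∘_)
open import Function.Bundles using (_⇔_; mk⇔; Equivalence)
open import Relation.Nullary using (¬_; Dec; yes; no)
open import Relation.Nullary.Decidable using (_×-dec_)
open import Relation.Binary using (tri<; tri≈; tri>)
open import Relation.Binary.PropositionalEquality
open +-*-Solver

if-dec-yes : ∀ {P : Set} (d : Dec P) {x} → P → if-dec d x ≡ x
if-dec-yes (yes _) p = refl
if-dec-yes (no ¬p) p = ⊥-elim (¬p p)

if-dec-no : ∀ {P : Set} (d : Dec P) {x} → ¬ P → if-dec d x ≡ 0ℚ
if-dec-no (yes p) ¬p = ⊥-elim (¬p p)
if-dec-no (no _)  ¬p = refl

if-dec-⇔ : ∀ {P Q : Set} (d : Dec P) (d′ : Dec Q) {x} → (P → Q) → (Q → P) →
           if-dec d x ≡ if-dec d′ x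
if-dec-⇔ (yes p) (yes q) f g = refl
if-dec-⇔ (yes p) (no ¬q) f g = ⊥-elim (¬q (f p))
if-dec-⇔ (no ¬p) (yes q) f g = ⊥-elim (¬p (g q))
if-dec-⇔ (no ¬p) (no ¬q) f g = refl

if-dec-cong : ∀ {P : Set} (d : Dec P) {x y} → (P → x ≡ y) → if-dec d x ≡ if-dec d y
if-dec-cong (yes p) x≡y = x≡y p
if-dec-cong (no _)  x≡y = refl

if-dec-0 : ∀ {P : Set} (d : Dec P) → if-dec d 0ℚ ≡ 0ℚ
if-dec-0 (yes _) = refl
if-dec-0 (no _)  = refl

if-dec-+ : ∀ {P : Set} (d : Dec P) x y → if-dec d (x + y) ≡ if-dec d x + if-dec d y
if-dec-+ (yes _) x y = refl
if-dec-+ (no _)  x y = refl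

if-dec-- : ∀ {P : Set} (d : Dec P) x y → if-dec d (x - y) ≡ if-dec d x - if-dec d y
if-dec-- (yes _) x y = refl
if-dec-- (no _)  x y = refl

*-if-dec : ∀ {P : Set} (d : Dec P) t x → t * if-dec d x ≡ if-dec d (t * x)
*-if-dec (yes _) t x = refl
*-if-dec (no _)  t x = *-zeroʳ t

if-dec-comm : ∀ {P Q : Set} (d : Dec P) (d′ : Dec Q) x →
              if-dec d (if-dec d′ x) ≡ if-dec d′ (if-dec d x)
if-dec-comm (yes _) (yes _) x = refl
if-dec-comm (yes _) (no _)  x = refl
if-dec-comm (no _)  (yes _) x = refl
if-dec-comm (no _)  (no _)  x = refl

if-dec-mono : ∀ {P : Set} (d : Dec P) {x y} → (P → x ≤ y) → if-dec d x ≤ if-dec d y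
if-dec-mono (yes p) x≤y = x≤y p
if-dec-mono (no _)  x≤y = ≤-refl

if-dec-nonneg : ∀ {P : Set} (d : Dec P) {x} → 0ℚ ≤ x → 0ℚ ≤ if-dec d x
if-dec-nonneg (yes _) 0≤x = 0≤x
if-dec-nonneg (no _)  0≤x = ≤-refl

∑-cong : ∀ m {f g : Fin m → ℚ} → (∀ i → f i ≡ g i) → ∑ m f ≡ ∑ m g
∑-cong zero    f≡g = refl
∑-cong (suc m) f≡g = cong₂ _+_ (f≡g zero) (∑-cong m (λ i → f≡g (suc i)))

∑-zero : ∀ m {f : Fin m → ℚ} → (∀ i → f i ≡ 0ℚ) → ∑ m f ≡ 0ℚ
∑-zero zero    f≡0 = refl
∑-zero (suc m) f≡0 = cong₂ _+_ (f≡0 zero) (∑-zero m (λ i → f≡0 (suc i)))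

∑-distrib-+ : ∀ m (f g : Fin m → ℚ) → ∑ m (λ i → f i + g i) ≡ ∑ m f + ∑ m g
∑-distrib-+ zero    f g = refl
∑-distrib-+ (suc m) f g = begin
    f zero + g zero + ∑ m (λ i → f (suc i) + g (suc i))
  ≡⟨ cong (f zero + g zero +_) (∑-distrib-+ m _ _) ⟩
    f zero + g zero + (∑ m (λ i → f (suc i)) + ∑ m (λ i → g (suc i)))
  ≡⟨ solve 4 (λ a b c d → a :+ b :+ (c :+ d) := a :+ c :+ (b :+ d)) refl (f zero) (g zero) _ _ ⟩
    f zero + ∑ m (λ i → f (suc i)) + (g zero + ∑ m (λ i → g (suc i))) ∎
  where open ≡-Reasoning

∑-distrib-- : ∀ m (f g : Fin m → ℚ) → ∑ m (λ i → f i - g i) ≡ ∑ m f - ∑ m g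
∑-distrib-- zero    f g = refl
∑-distrib-- (suc m) f g = begin
    f zero - g zero + ∑ m (λ i → f (suc i) - g (suc i))
  ≡⟨ cong (f zero - g zero +_) (∑-distrib-- m _ _) ⟩
    f zero - g zero + (∑ m (λ i → f (suc i)) - ∑ m (λ i → g (suc i)))
  ≡⟨ solve 4 (λ a b c d → a :- b :+ (c :- d) := a :+ c :- (b :+ d)) refl (f zero) (g zero) _ _ ⟩
    f zero + ∑ m (λ i → f (suc i)) - (g zero + ∑ m (λ i → g (suc i))) ∎
  where open ≡-Reasoning

*-distribˡ-∑ : ∀ m t (f : Fin m → ℚ) → t * ∑ m f ≡ ∑ m (λ i → t * f i)
*-distribˡ-∑ zero    t f = *-zeroʳ t
*-distribˡ-∑ (suc m) t f =
  trans (*-distribˡ-+ t (f zero) _) (cong (t * f zero +_) (*-distribˡ-∑ m t _))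

∑-mono-≤ : ∀ m {f g : Fin m → ℚ} → (∀ i → f i ≤ g i) → ∑ m f ≤ ∑ m g
∑-mono-≤ zero    f≤g = ≤-refl
∑-mono-≤ (suc m) f≤g = +-mono-≤ (f≤g zero) (∑-mono-≤ m (λ i → f≤g (suc i)))

∑-mono-< : ∀ m {f g : Fin m → ℚ} → (∀ i → f i ≤ g i) → ∀ k → f k < g k → ∑ m f < ∑ m g
∑-mono-< (suc m) f≤g zero    fk<gk = +-mono-<-≤ fk<gk (∑-mono-≤ m (λ i → f≤g (suc i)))
∑-mono-< (suc m) f≤g (suc k) fk<gk = +-mono-≤-< (f≤g zero) (∑-mono-< m (λ i → f≤g (suc i)) k fk<gk)

∑-nonneg : ∀ m {f : Fin m → ℚ} → (∀ i → 0ℚ ≤ f i) → 0ℚ ≤ ∑ m f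
∑-nonneg m {f} 0≤f = subst (_≤ ∑ m f) (∑-zero m (λ _ → refl)) (∑-mono-≤ m 0≤f)

∑-comm : ∀ n m (h : Fin n → Fin m → ℚ) →
         ∑ n (λ i → ∑ m (h i)) ≡ ∑ m (λ j → ∑ n (λ i → h i j))
∑-comm zero    m h = sym (∑-zero m (λ _ → refl))
∑-comm (suc n) m h = trans (cong (∑ m (h zero) +_) (∑-comm n m (λ i → h (suc i))))
                           (sym (∑-distrib-+ m (h zero) _))

∑-δ : ∀ n (k : Fin n) (g : Fin n → ℚ) → ∑ n (λ w → if-dec (k ≟ w) (g w)) ≡ g k
∑-δ (suc n) zero    g = trans (cong (g zero +_) (∑-zero n (λ w → if-dec-no (zero ≟ suc w) {g (suc w)} λ ())))
                              (+-identityʳ (g zero))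
∑-δ (suc n) (suc k) g = begin
    if-dec (suc k ≟ zero) (g zero) + ∑ n (λ w → if-dec (suc k ≟ suc w) (g (suc w)))
  ≡⟨ cong₂ _+_ (if-dec-no (suc k ≟ zero) {g zero} λ ())
               (∑-cong n (λ w → if-dec-⇔ (suc k ≟ suc w) (k ≟ w) suc-injective (cong suc))) ⟩
    0ℚ + ∑ n (λ w → if-dec (k ≟ w) (g (suc w)))
  ≡⟨ +-identityˡ _ ⟩
    ∑ n (λ w → if-dec (k ≟ w) (g (suc w)))
  ≡⟨ ∑-δ n k (λ w → g (suc w)) ⟩
    g (suc k) ∎
  where open ≡-Reasoning

∑-partition : ∀ n m (t : Fin m → Fin n) (g : Fin m → ℚ) →
              ∑ m g ≡ ∑ n (λ u → ∑ m (λ e → if-dec (t e ≟ u) (g e)))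
∑-partition n m t g = sym (trans (∑-comm n m _) (∑-cong m (λ e → ∑-δ n (t e) (λ _ → g e))))

if-dec-∑ : ∀ {P : Set} (d : Dec P) m (f : Fin m → ℚ) → if-dec d (∑ m f) ≡ ∑ m (λ i → if-dec d (f i))
if-dec-∑ (yes _) m f = refl
if-dec-∑ (no _)  m f = sym (∑-zero m (λ _ → refl))

∑-fibres : ∀ n m {P : Fin n → Set} (P? : ∀ w → Dec (P w)) (t : Fin m → Fin n) (h : Fin m → ℚ) →
  ∑ n (λ w → if-dec (P? w) (∑ m (λ e → if-dec (t e ≟ w) (h e)))) ≡ ∑ m (λ e → if-dec (P? (t e)) (h e))
∑-fibres n m P? t h = begin
    ∑ n (λ w → if-dec (P? w) (∑ m (λ e → if-dec (t e ≟ w) (h e))))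
  ≡⟨ ∑-cong n (λ w → if-dec-∑ (P? w) m _) ⟩
    ∑ n (λ w → ∑ m (λ e → if-dec (P? w) (if-dec (t e ≟ w) (h e))))
  ≡⟨ ∑-comm n m _ ⟩
    ∑ m (λ e → ∑ n (λ w → if-dec (P? w) (if-dec (t e ≟ w) (h e))))
  ≡⟨ ∑-cong m (λ e → ∑-cong n (λ w → if-dec-comm (P? w) (t e ≟ w) (h e))) ⟩
    ∑ m (λ e → ∑ n (λ w → if-dec (t e ≟ w) (if-dec (P? w) (h e))))
  ≡⟨ ∑-cong m (λ e → ∑-δ n (t e) (λ w → if-dec (P? w) (h e))) ⟩
    ∑ m (λ e → if-dec (P? (t e)) (h e)) ∎
  where open ≡-Reasoning

p≤q⇒0≤q-p : ∀ {p q} → p ≤ q → 0ℚ ≤ q - p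
p≤q⇒0≤q-p {p} {q} p≤q = subst (_≤ q - p) (+-inverseʳ p) (+-monoˡ-≤ (- p) p≤q)

p<q⇒0<q-p : ∀ {p q} → p < q → 0ℚ < q - p
p<q⇒0<q-p {p} {q} p<q = subst (_< q - p) (+-inverseʳ p) (+-monoˡ-< (- p) p<q)

clamp : ℚ → ℚ → ℚ → ℚ
clamp c d x = d ⊓ (c ⊔ x)

clamp-mono : ∀ c d {x y} → x ≤ y → clamp c d x ≤ clamp c d y
clamp-mono c d x≤y = ⊓-monoʳ-≤ d (⊔-monoʳ-≤ c x≤y)

clamp-below : ∀ {c d x} → c ≤ d → x ≤ c → clamp c d x ≡ c
clamp-below {c} {d} c≤d x≤c = trans (cong (d ⊓_) (p≥q⇒p⊔q≡p x≤c)) (p≥q⇒p⊓q≡q c≤d)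

clamp-above : ∀ {c d x} → c ≤ d → d ≤ x → clamp c d x ≡ d
clamp-above {c} {d} c≤d d≤x = trans (cong (d ⊓_) (p≤q⇒p⊔q≡q (≤-trans c≤d d≤x))) (p≤q⇒p⊓q≡p d≤x)

clamp-between : ∀ {c d x} → c ≤ x → x ≤ d → clamp c d x ≡ x
clamp-between {c} {d} c≤x x≤d = trans (cong (d ⊓_) (p≤q⇒p⊔q≡q c≤x)) (p≥q⇒p⊓q≡q x≤d)

clamp-degenerate : ∀ c x → clamp c c x ≡ c
clamp-degenerate c x with ≤-total x c
... | inj₁ x≤c = clamp-below ≤-refl x≤c
... | inj₂ c≤x = clamp-above ≤-refl c≤x

-- For x ≤ y, the length of [x, y] ∩ [c, d].
intersect : (c d x y : ℚ) → ℚ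
intersect c d x y = clamp c d y - clamp c d x

intersect-outside : ∀ {c d x y} → c ≤ d → x ≤ y → y ≤ c ⊎ d ≤ x → intersect c d x y ≡ 0ℚ
intersect-outside {c} c≤d x≤y (inj₁ y≤c) =
  trans (cong₂ _-_ (clamp-below c≤d y≤c) (clamp-below c≤d (≤-trans x≤y y≤c))) (+-inverseʳ c)
intersect-outside {d = d} c≤d x≤y (inj₂ d≤x) =
  trans (cong₂ _-_ (clamp-above c≤d (≤-trans d≤x x≤y)) (clamp-above c≤d d≤x)) (+-inverseʳ d)

intersect-inside : ∀ {c d x y} → c ≤ d → c ≤ y → x ≤ d → intersect c d x y ≡ (y ⊓ d) - (x ⊔ c)
intersect-inside {c} {d} {x} {y} c≤d c≤y x≤d = cong₂ _-_
  (trans (cong (d ⊓_) (p≤q⇒p⊔q≡q c≤y)) (⊓-comm d y))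
  (trans (p≥q⇒p⊓q≡q (⊔-lub c≤d x≤d)) (⊔-comm c x))

Nonoverlapping : ∀ {m} (c d : Fin m → ℚ) → Set
Nonoverlapping c d = ∀ i j → i ≢ j → d i ≤ c j ⊎ d j ≤ c i

nonoverlapping-tail : ∀ {m} {c d : Fin (suc m) → ℚ} →
                      Nonoverlapping c d → Nonoverlapping (c ∘ suc) (d ∘ suc)
nonoverlapping-tail disj i j i≢j = disj (suc i) (suc j) (i≢j ∘ suc-injective)

covered : ∀ m (c d : Fin m → ℚ) (x y : ℚ) → ℚ
covered m c d x y = ∑ m (λ i → intersect (c i) (d i) x y)

covered-split : ∀ m (c d : Fin m → ℚ) x x₁ x₂ y →
  covered m c d x y ≡ covered m c d x x₁ + covered m c d x₁ x₂ + covered m c d x₂ y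
covered-split m c d x x₁ x₂ y = begin
    covered m c d x y
  ≡⟨ ∑-cong m (λ i → solve 4 (λ p q r s → s :- p := (q :- p) :+ (r :- q) :+ (s :- r)) refl
                       (clamp (c i) (d i) x) (clamp (c i) (d i) x₁) (clamp (c i) (d i) x₂) (clamp (c i) (d i) y)) ⟩
    ∑ m (λ i → intersect (c i) (d i) x x₁ + intersect (c i) (d i) x₁ x₂ + intersect (c i) (d i) x₂ y)
  ≡⟨ ∑-distrib-+ m _ _ ⟩
    ∑ m (λ i → intersect (c i) (d i) x x₁ + intersect (c i) (d i) x₁ x₂) + covered m c d x₂ y
  ≡⟨ cong (_+ covered m c d x₂ y) (∑-distrib-+ m _ _) ⟩
    covered m c d x x₁ + covered m c d x₁ x₂ + covered m c d x₂ y ∎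
  where open ≡-Reasoning

module _ {m : ℕ} {c d : Fin (suc m) → ℚ} (c≤d : ∀ i → c i ≤ d i) where

  covered-suc-outside : ∀ {x y} → x ≤ y → y ≤ c zero ⊎ d zero ≤ x →
                        covered (suc m) c d x y ≡ covered m (c ∘ suc) (d ∘ suc) x y
  covered-suc-outside x≤y out =
    trans (cong (_+ covered m (c ∘ suc) (d ∘ suc) _ _) (intersect-outside (c≤d zero) x≤y out)) (+-identityˡ _)

  -- Between x ⊔ c₀ and y ⊓ d₀ only the first interval grows.
  covered-suc-inside : Nonoverlapping c d → ∀ {x y} → x ≤ y → c zero ≤ y → x ≤ d zero →
    covered (suc m) c d x y ≡
      (y ⊓ d zero) - (x ⊔ c zero) +
      (covered m (c ∘ suc) (d ∘ suc) x (x ⊔ c zero) + covered m (c ∘ suc) (d ∘ suc) (y ⊓ d zero) y)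
  covered-suc-inside disj {x} {y} x≤y c₀≤y x≤d₀ = begin
      intersect (c zero) (d zero) x y + C x y
    ≡⟨ cong₂ _+_ (intersect-inside (c≤d zero) c₀≤y x≤d₀) (covered-split m (c ∘ suc) (d ∘ suc) x x₁ x₂ y) ⟩
      x₂ - x₁ + (C x x₁ + C x₁ x₂ + C x₂ y)
    ≡⟨ cong (λ z → x₂ - x₁ + (C x x₁ + z + C x₂ y)) (∑-zero m middle-vanishes) ⟩
      x₂ - x₁ + (C x x₁ + 0ℚ + C x₂ y)
    ≡⟨ cong (λ z → x₂ - x₁ + (z + C x₂ y)) (+-identityʳ (C x x₁)) ⟩
      x₂ - x₁ + (C x x₁ + C x₂ y) ∎
    where
    open ≡-Reasoning
    C : ℚ → ℚ → ℚ
    C = covered m (c ∘ suc) (d ∘ suc)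
    x₁ x₂ : ℚ
    x₁ = x ⊔ c zero
    x₂ = y ⊓ d zero
    x₁≤x₂ : x₁ ≤ x₂
    x₁≤x₂ = ⊓-glb (⊔-lub x≤y c₀≤y) (⊔-lub x≤d₀ (c≤d zero))
    middle-vanishes : ∀ i → intersect (c (suc i)) (d (suc i)) x₁ x₂ ≡ 0ℚ
    middle-vanishes i = intersect-outside (c≤d (suc i)) x₁≤x₂ (separate (disj zero (suc i) λ ()))
      where
      separate : d zero ≤ c (suc i) ⊎ d (suc i) ≤ c zero → x₂ ≤ c (suc i) ⊎ d (suc i) ≤ x₁
      separate (inj₁ d₀≤cᵢ) = inj₁ (≤-trans (p⊓q≤q y (d zero)) d₀≤cᵢ)
      separate (inj₂ dᵢ≤c₀) = inj₂ (≤-trans dᵢ≤c₀ (p≤q⊔p x (c zero)))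

telescope-≤ : ∀ x x₁ x₂ y {X Y} → X ≤ x₁ - x → Y ≤ y - x₂ → x₂ - x₁ + (X + Y) ≤ y - x
telescope-≤ x x₁ x₂ y X≤ Y≤ =
  subst (_ ≤_) (solve 4 (λ x x₁ x₂ y → x₂ :- x₁ :+ (x₁ :- x :+ (y :- x₂)) := y :- x) refl x x₁ x₂ y)
        (+-monoʳ-≤ (x₂ - x₁) (+-mono-≤ X≤ Y≤))

telescope-< : ∀ x x₁ x₂ y {X Y} → X < x₁ - x → Y ≤ y - x₂ → x₂ - x₁ + (X + Y) < y - x
telescope-< x x₁ x₂ y X< Y≤ =
  subst (_ <_) (solve 4 (λ x x₁ x₂ y → x₂ :- x₁ :+ (x₁ :- x :+ (y :- x₂)) := y :- x) refl x x₁ x₂ y)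
        (+-monoʳ-< (x₂ - x₁) (+-mono-<-≤ X< Y≤))

covered-≤ : ∀ m {c d : Fin m → ℚ} → (∀ i → c i ≤ d i) → Nonoverlapping c d →
            ∀ {x y} → x ≤ y → covered m c d x y ≤ y - x
covered-≤ zero    c≤d disj x≤y = p≤q⇒0≤q-p x≤y
covered-≤ (suc m) {c} {d} c≤d disj {x} {y} x≤y = cases (≤-total y (c zero)) (≤-total (d zero) x)
  where
  IH : ∀ {x y} → x ≤ y → covered m (c ∘ suc) (d ∘ suc) x y ≤ y - x
  IH = covered-≤ m (c≤d ∘ suc) (nonoverlapping-tail disj)
  outside : y ≤ c zero ⊎ d zero ≤ x → covered (suc m) c d x y ≤ y - x
  outside out = subst (_≤ y - x) (sym (covered-suc-outside c≤d x≤y out)) (IH x≤y)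
  cases : y ≤ c zero ⊎ c zero ≤ y → d zero ≤ x ⊎ x ≤ d zero → covered (suc m) c d x y ≤ y - x
  cases (inj₁ y≤c₀) _           = outside (inj₁ y≤c₀)
  cases (inj₂ _)    (inj₁ d₀≤x) = outside (inj₂ d₀≤x)
  cases (inj₂ c₀≤y) (inj₂ x≤d₀) = subst (_≤ y - x) (sym (covered-suc-inside c≤d disj x≤y c₀≤y x≤d₀))
    (telescope-≤ x (x ⊔ c zero) (y ⊓ d zero) y (IH (p≤p⊔q x (c zero))) (IH (p⊓q≤p y (d zero))))

covered-< : ∀ m {c d : Fin m → ℚ} → (∀ i → c i ≤ d i) → Nonoverlapping c d →
            ∀ {x y} → (∀ i → ¬ (c i ≤ x × x < d i)) → x < y → covered m c d x y < y - x
covered-< zero    c≤d disj x∉ x<y = p<q⇒0<q-p x<y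
covered-< (suc m) {c} {d} c≤d disj {x} {y} x∉ x<y = cases (c zero ≤? x) (≤-total y (c zero))
  where
  IH≤ : ∀ {x y} → x ≤ y → covered m (c ∘ suc) (d ∘ suc) x y ≤ y - x
  IH≤ = covered-≤ m (c≤d ∘ suc) (nonoverlapping-tail disj)
  IH< : ∀ {y} → x < y → covered m (c ∘ suc) (d ∘ suc) x y < y - x
  IH< = covered-< m (c≤d ∘ suc) (nonoverlapping-tail disj) (x∉ ∘ suc)
  outside : y ≤ c zero ⊎ d zero ≤ x → covered (suc m) c d x y < y - x
  outside out = subst (_< y - x) (sym (covered-suc-outside c≤d (<⇒≤ x<y) out)) (IH< x<y)
  cases : Dec (c zero ≤ x) → y ≤ c zero ⊎ c zero ≤ y → covered (suc m) c d x y < y - x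
  cases (yes c₀≤x) _           = outside (inj₂ (≮⇒≥ (λ x<d₀ → x∉ zero (c₀≤x , x<d₀))))
  cases (no _)     (inj₁ y≤c₀) = outside (inj₁ y≤c₀)
  cases (no c₀≰x)  (inj₂ c₀≤y) = subst (_< y - x) (sym (covered-suc-inside c≤d disj (<⇒≤ x<y) c₀≤y x≤d₀))
    (telescope-< x (x ⊔ c zero) (y ⊓ d zero) y (IH< (<-≤-trans x<c₀ (p≤q⊔p x (c zero))))
                                               (IH≤ (p⊓q≤p y (d zero))))
    where
    x<c₀ : x < c zero
    x<c₀ = ≰⇒> c₀≰x
    x≤d₀ : x ≤ d zero
    x≤d₀ = <⇒≤ (<-≤-trans x<c₀ (c≤d zero))

toℚ-nonneg : ∀ k → 0ℚ ≤ toℚ k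
toℚ-nonneg k = nonNegative⁻¹ (toℚ k) {{normalize-nonNeg k 1}}

module EdgeRanking {n m : ℕ} (F : Network n m) where

  ℓ : Fin m → ℚ
  ℓ e = toℚ (liab F e)

  ranked-before : Fin m → Fin m → ℚ
  ranked-before e k = if-dec (src F k ≟ src F e) (if-dec (rank F k ℕ.<? rank F e) (ℓ k))

  ranked-before-nonneg : ∀ e k → 0ℚ ≤ ranked-before e k
  ranked-before-nonneg e k =
    if-dec-nonneg (src F k ≟ src F e) (if-dec-nonneg (rank F k ℕ.<? rank F e) (toℚ-nonneg (liab F k)))

  before-nonneg : ∀ e → 0ℚ ≤ before F e
  before-nonneg e = ∑-nonneg m (ranked-before-nonneg e)

  before≤before+ℓ : ∀ e → before F e ≤ before F e + ℓ e
  before≤before+ℓ e =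
    subst (_≤ before F e + ℓ e) (+-identityʳ (before F e)) (+-monoʳ-≤ (before F e) (toℚ-nonneg (liab F e)))

  pay-clamp : ∀ e x → pay F e x ≡ clamp (before F e) (before F e + ℓ e) x - before F e
  pay-clamp e x = sym (begin
      (b + ℓ e) ⊓ (b ⊔ x) - b
    ≡⟨ mono-≤-distrib-⊓ (+-monoˡ-≤ (- b)) (b + ℓ e) (b ⊔ x) ⟩
      (b + ℓ e - b) ⊓ (b ⊔ x - b)
    ≡⟨ cong₂ _⊓_ (solve 2 (λ b l → b :+ l :- b := l) refl b (ℓ e))
                 (mono-≤-distrib-⊔ (+-monoˡ-≤ (- b)) b x) ⟩
      ℓ e ⊓ ((b - b) ⊔ (x - b))
    ≡⟨ cong (λ z → ℓ e ⊓ (z ⊔ (x - b))) (+-inverseʳ b) ⟩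
      ℓ e ⊓ (0ℚ ⊔ (x - b)) ∎)
    where
    open ≡-Reasoning
    b : ℚ
    b = before F e

  pay-increase : ∀ e x y → pay F e y - pay F e x ≡ intersect (before F e) (before F e + ℓ e) x y
  pay-increase e x y = trans (cong₂ _-_ (pay-clamp e y) (pay-clamp e x))
    (solve 3 (λ p q b → (p :- b) :- (q :- b) := p :- q) refl
      (clamp (before F e) (before F e + ℓ e) y) (clamp (before F e) (before F e + ℓ e) x) (before F e))

  pay-mono : ∀ e {x y} → x ≤ y → pay F e x ≤ pay F e y
  pay-mono e {x} {y} x≤y = subst₂ _≤_ (sym (pay-clamp e x)) (sym (pay-clamp e y))
    (+-monoˡ-≤ (- before F e) (clamp-mono (before F e) (before F e + ℓ e) x≤y))

  pay-below : ∀ e {x} → x ≤ before F e → pay F e x ≡ 0ℚ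
  pay-below e {x} x≤b = trans (pay-clamp e x)
    (trans (cong (_- before F e) (clamp-below (before≤before+ℓ e) x≤b)) (+-inverseʳ (before F e)))

  pay-above : ∀ e {x} → before F e + ℓ e ≤ x → pay F e x ≡ ℓ e
  pay-above e {x} b+ℓ≤x = trans (pay-clamp e x)
    (trans (cong (_- before F e) (clamp-above (before≤before+ℓ e) b+ℓ≤x))
           (solve 2 (λ b l → b :+ l :- b := l) refl (before F e) (ℓ e)))

  pay-between : ∀ e {x} → before F e ≤ x → x ≤ before F e + ℓ e → pay F e x ≡ x - before F e
  pay-between e {x} b≤x x≤b+ℓ = trans (pay-clamp e x) (cong (_- before F e) (clamp-between b≤x x≤b+ℓ))

  pay-flat : ∀ e {x y} → x ≤ y → y ≤ before F e ⊎ before F e + ℓ e ≤ x → pay F e y ≡ pay F e x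
  pay-flat e x≤y (inj₁ y≤b)   = trans (pay-below e y≤b) (sym (pay-below e (≤-trans x≤y y≤b)))
  pay-flat e x≤y (inj₂ b+ℓ≤x) = trans (pay-above e (≤-trans b+ℓ≤x x≤y)) (sym (pay-above e b+ℓ≤x))

  PartiallyPaid : Fin m → ℚ → Set
  PartiallyPaid e x = before F e ≤ x × x < before F e + ℓ e

  partially-paid? : ∀ e x → Dec (PartiallyPaid e x)
  partially-paid? e x = (before F e ≤? x) ×-dec (x <? before F e + ℓ e)

  pay-strict : ∀ e {x y} → PartiallyPaid e x → x < y → pay F e x < pay F e y
  pay-strict e {x} {y} (b≤x , x<b+ℓ) x<y = subst (_< pay F e y) (sym (pay-between e b≤x (<⇒≤ x<b+ℓ)))
    (case (≤-total y (before F e + ℓ e)))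
    where
    case : y ≤ before F e + ℓ e ⊎ before F e + ℓ e ≤ y → x - before F e < pay F e y
    case (inj₁ y≤b+ℓ) = subst (x - before F e <_) (sym (pay-between e (≤-trans b≤x (<⇒≤ x<y)) y≤b+ℓ))
                          (+-monoˡ-< (- before F e) x<y)
    case (inj₂ b+ℓ≤y) = subst (x - before F e <_) (sym (trans (pay-above e b+ℓ≤y)
                              (solve 2 (λ b l → l := b :+ l :- b) refl (before F e) (ℓ e))))
                          (+-monoˡ-< (- before F e) x<b+ℓ)

  ranked-before-mono : ∀ {e e′} → src F e ≡ src F e′ → rank F e ℕ.< rank F e′ →
                       ∀ k → ranked-before e k ≤ ranked-before e′ k
  ranked-before-mono {e} {e′} se re k with src F k ≟ src F e | rank F k ℕ.<? rank F e
  ... | yes sk | yes rk = ≤-reflexive (sym (trans (if-dec-yes (src F k ≟ src F e′) (trans sk se))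
                                                  (if-dec-yes (rank F k ℕ.<? rank F e′) (ℕ.<-trans rk re))))
  ... | yes _  | no _   = ranked-before-nonneg e′ k
  ... | no _   | _      = ranked-before-nonneg e′ k

  before-separated : ∀ {e e′} → src F e ≡ src F e′ → rank F e ℕ.< rank F e′ →
                     before F e + ℓ e ≤ before F e′
  before-separated {e} {e′} se re = subst (_≤ before F e′) decompose (∑-mono-≤ m pointwise)
    where
    decompose : ∑ m (λ k → ranked-before e k + if-dec (e ≟ k) (ℓ k)) ≡ before F e + ℓ e
    decompose = trans (∑-distrib-+ m (ranked-before e) _) (cong (before F e +_) (∑-δ m e ℓ))
    pointwise : ∀ k → ranked-before e k + if-dec (e ≟ k) (ℓ k) ≤ ranked-before e′ k
    pointwise k with e ≟ k
    ... | yes refl = ≤-reflexive (trans (cong (_+ ℓ e) not-before-itself) (trans (+-identityˡ (ℓ e))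
                       (sym (trans (if-dec-yes (src F e ≟ src F e′) se) (if-dec-yes (rank F e ℕ.<? rank F e′) re)))))
      where
      not-before-itself : ranked-before e e ≡ 0ℚ
      not-before-itself = trans (if-dec-cong (src F e ≟ src F e)
                                   (λ _ → if-dec-no (rank F e ℕ.<? rank F e) (ℕ.<-irrefl refl)))
                                (if-dec-0 (src F e ≟ src F e))
    ... | no _ = subst (_≤ ranked-before e′ k) (sym (+-identityʳ (ranked-before e k)))
                   (ranked-before-mono se re k)

  pay-other : WellFormed F → ∀ {e e*} → src F e* ≡ src F e → e* ≢ e →
              ∀ {x y} → before F e* ≤ x → y ≤ before F e* + ℓ e* → x ≤ y → pay F e y ≡ pay F e x
  pay-other wf {e} {e*} se* e*≢e b*≤x y≤b*+ℓ x≤y with ℕ.<-cmp (rank F e) (rank F e*)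
  ... | tri< r<r* _ _ = pay-flat e x≤y (inj₂ (≤-trans (before-separated (sym se*) r<r*) b*≤x))
  ... | tri≈ _ r≡r* _ = ⊥-elim (e*≢e (WellFormed.rankInj wf e* e se* (sym r≡r*)))
  ... | tri> _ _ r*<r = pay-flat e x≤y (inj₁ (≤-trans y≤b*+ℓ (before-separated se* r*<r)))

  lower upper : Fin n → Fin m → ℚ
  lower u e = if-dec (src F e ≟ u) (before F e)
  upper u e = if-dec (src F e ≟ u) (before F e + ℓ e)

  lower≤upper : ∀ u e → lower u e ≤ upper u e
  lower≤upper u e with src F e ≟ u
  ... | yes _ = before≤before+ℓ e
  ... | no _  = ≤-refl

  nonoverlapping : WellFormed F → ∀ u → Nonoverlapping (lower u) (upper u)
  nonoverlapping wf u i j i≢j with src F i ≟ u | src F j ≟ u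
  ... | no _   | sj?    = inj₁ (if-dec-nonneg sj? (before-nonneg j))
  ... | yes _  | no _   = inj₂ (before-nonneg i)
  ... | yes si | yes sj with ℕ.<-cmp (rank F i) (rank F j)
  ...   | tri< ri<rj _ _ = inj₁ (before-separated (trans si (sym sj)) ri<rj)
  ...   | tri≈ _ ri≡rj _ = ⊥-elim (i≢j (WellFormed.rankInj wf i j (trans si (sym sj)) ri≡rj))
  ...   | tri> _ _ rj<ri = inj₂ (before-separated (trans sj (sym si)) rj<ri)

  payout-increase : Fin n → ℚ → ℚ → ℚ
  payout-increase u x y = ∑ m (λ e → if-dec (src F e ≟ u) (pay F e y - pay F e x))

  payout-increase≡covered : ∀ u x y → payout-increase u x y ≡ covered m (lower u) (upper u) x y
  payout-increase≡covered u x y = ∑-cong m pointwise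
    where
    pointwise : ∀ e → if-dec (src F e ≟ u) (pay F e y - pay F e x) ≡ intersect (lower u e) (upper u e) x y
    pointwise e with src F e ≟ u
    ... | yes _ = pay-increase e x y
    ... | no _  = sym (trans (cong₂ _-_ (clamp-degenerate 0ℚ y) (clamp-degenerate 0ℚ x)) (+-inverseʳ 0ℚ))

  payout-increase-≤ : WellFormed F → ∀ u {x y} → x ≤ y → payout-increase u x y ≤ y - x
  payout-increase-≤ wf u {x} {y} x≤y = subst (_≤ y - x) (sym (payout-increase≡covered u x y))
    (covered-≤ m (lower≤upper u) (nonoverlapping wf u) x≤y)

  payout-increase-< : WellFormed F → ∀ u {x y} → x < y →
    (∀ e → src F e ≡ u → ¬ PartiallyPaid e x) → payout-increase u x y < y - x
  payout-increase-< wf u {x} {y} x<y none = subst (_< y - x) (sym (payout-increase≡covered u x y))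
    (covered-< m (lower≤upper u) (nonoverlapping wf u) x∉ x<y)
    where
    x∉ : ∀ e → ¬ (lower u e ≤ x × x < upper u e)
    x∉ e with src F e ≟ u
    ... | yes se = none e se
    ... | no _   = λ (0≤x , x<0) → <-irrefl refl (≤-<-trans 0≤x x<0)

  PartiallyPaidClosed : (Fin n → ℚ) → (Fin n → Set) → Set
  PartiallyPaidClosed a D = ∀ u → D u → ∃ λ e → src F e ≡ u × PartiallyPaid e (a u) × D (tgt F e)

retarget : ∀ {n m} → Network n m → (Fin m → Fin n) → Network n m
retarget F tgt′ = record F { tgt = tgt′ }

-- Conservation of money: the total gain of the gaining banks is the extra money paid into them,
-- which is at most the extra money they pay out, which is at most their total gain, since a bank
-- paying along a ranking never pays out more than its extra assets.  A gaining bank without a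
-- partially paid edge into a gaining bank would make one of these inequalities strict.
module _ {n m : ℕ} (F : Network n m) (wf : WellFormed F) (tgt′ : Fin m → Fin n) {a a′ : Fin n → ℚ}
  (feasible : Feasible F a) (feasible′ : Feasible (retarget F tgt′) a′)
  (same-gain : ∀ e → (a (tgt F e) < a′ (tgt F e)) ⇔ (a (tgt′ e) < a′ (tgt′ e))) where

  open EdgeRanking F

  private
    Gains : Fin n → Set
    Gains w = a w < a′ w

    gains? : ∀ w → Dec (Gains w)
    gains? w = a w <? a′ w

    paid paid′ extra : Fin m → ℚ
    paid  e = pay F e (a (src F e))
    paid′ e = pay F e (a′ (src F e))
    extra e = paid′ e - paid e

    total-gain extra-into-gainers extra-out-of-gainers total-payout-increase : ℚ
    total-gain            = ∑ n (λ w → if-dec (gains? w) (a′ w - a w))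
    extra-into-gainers    = ∑ m (λ e → if-dec (gains? (tgt F e)) (extra e))
    extra-out-of-gainers  = ∑ m (λ e → if-dec (gains? (src F e)) (extra e))
    total-payout-increase = ∑ n (λ u → if-dec (gains? u) (payout-increase u (a u) (a′ u)))

    gain≡inflow-difference : ∀ w →
      a′ w - a w ≡ ∑ m (λ e → if-dec (tgt′ e ≟ w) (paid′ e)) - ∑ m (λ e → if-dec (tgt F e ≟ w) (paid e))
    gain≡inflow-difference w = trans (cong₂ _-_ (proj₂ feasible′ w) (proj₂ feasible w))
      (solve 3 (λ x p q → (x :+ p) :- (x :+ q) := p :- q) refl (toℚ (ext F w)) _ _)

    total-gain≡extra-into-gainers : total-gain ≡ extra-into-gainers
    total-gain≡extra-into-gainers = begin
        ∑ n (λ w → if-dec (gains? w) (a′ w - a w))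
      ≡⟨ ∑-cong n (λ w → trans (cong (if-dec (gains? w)) (gain≡inflow-difference w)) (if-dec-- (gains? w) _ _)) ⟩
        ∑ n (λ w → if-dec (gains? w) (∑ m (λ e → if-dec (tgt′ e ≟ w) (paid′ e)))
                 - if-dec (gains? w) (∑ m (λ e → if-dec (tgt F e ≟ w) (paid e))))
      ≡⟨ ∑-distrib-- n _ _ ⟩
        ∑ n (λ w → if-dec (gains? w) (∑ m (λ e → if-dec (tgt′ e ≟ w) (paid′ e))))
          - ∑ n (λ w → if-dec (gains? w) (∑ m (λ e → if-dec (tgt F e ≟ w) (paid e))))
      ≡⟨ cong₂ _-_ (∑-fibres n m gains? tgt′ paid′) (∑-fibres n m gains? (tgt F) paid) ⟩
        ∑ m (λ e → if-dec (gains? (tgt′ e)) (paid′ e)) - ∑ m (λ e → if-dec (gains? (tgt F e)) (paid e))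
      ≡⟨ cong (_- ∑ m (λ e → if-dec (gains? (tgt F e)) (paid e)))
              (∑-cong m (λ e → if-dec-⇔ (gains? (tgt′ e)) (gains? (tgt F e))
                                        (Equivalence.from (same-gain e)) (Equivalence.to (same-gain e)))) ⟩
        ∑ m (λ e → if-dec (gains? (tgt F e)) (paid′ e)) - ∑ m (λ e → if-dec (gains? (tgt F e)) (paid e))
      ≡⟨ sym (∑-distrib-- m _ _) ⟩
        ∑ m (λ e → if-dec (gains? (tgt F e)) (paid′ e) - if-dec (gains? (tgt F e)) (paid e))
      ≡⟨ ∑-cong m (λ e → sym (if-dec-- (gains? (tgt F e)) (paid′ e) (paid e))) ⟩
        ∑ m (λ e → if-dec (gains? (tgt F e)) (extra e)) ∎
      where open ≡-Reasoning

    extra-nonneg : ∀ e → Gains (src F e) → 0ℚ ≤ extra e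
    extra-nonneg e gain = p≤q⇒0≤q-p (pay-mono e (<⇒≤ gain))

    extra-nonpos : ∀ e → ¬ Gains (src F e) → extra e ≤ 0ℚ
    extra-nonpos e ¬gain =
      subst (extra e ≤_) (+-inverseʳ (paid e)) (+-monoˡ-≤ (- paid e) (pay-mono e (≮⇒≥ ¬gain)))

    into≤out : ∀ e → if-dec (gains? (tgt F e)) (extra e) ≤ if-dec (gains? (src F e)) (extra e)
    into≤out e = compare (gains? (src F e)) (gains? (tgt F e))
      where
      compare : (ds : Dec (Gains (src F e))) (dt : Dec (Gains (tgt F e))) → if-dec dt (extra e) ≤ if-dec ds (extra e)
      compare (yes _)    (yes _) = ≤-refl
      compare (yes gain) (no _)  = extra-nonneg e gain
      compare (no ¬gain) (yes _) = extra-nonpos e ¬gain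
      compare (no _)     (no _)  = ≤-refl

    extra-out-of-gainers≡total-payout-increase : extra-out-of-gainers ≡ total-payout-increase
    extra-out-of-gainers≡total-payout-increase = sym (trans
      (∑-cong n (λ u → cong (if-dec (gains? u)) (∑-cong m (λ e → if-dec-cong (src F e ≟ u) λ { refl → refl }))))
      (∑-fibres n m gains? (src F) extra))

    payout≤gain : ∀ u → if-dec (gains? u) (payout-increase u (a u) (a′ u)) ≤ if-dec (gains? u) (a′ u - a u)
    payout≤gain u = if-dec-mono (gains? u) (λ gain → payout-increase-≤ wf u (<⇒≤ gain))

    balance-is-tight : extra-into-gainers < extra-out-of-gainers ⊎ total-payout-increase < total-gain → ⊥
    balance-is-tight (inj₁ into<out) = <-irrefl refl (begin-strict
        total-gain             ≡⟨ total-gain≡extra-into-gainers ⟩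
        extra-into-gainers     <⟨ into<out ⟩
        extra-out-of-gainers   ≡⟨ extra-out-of-gainers≡total-payout-increase ⟩
        total-payout-increase  ≤⟨ ∑-mono-≤ n payout≤gain ⟩
        total-gain             ∎)
      where open ≤-Reasoning
    balance-is-tight (inj₂ payout<gain) = <-irrefl refl (begin-strict
        total-gain             ≡⟨ total-gain≡extra-into-gainers ⟩
        extra-into-gainers     ≤⟨ ∑-mono-≤ m into≤out ⟩
        extra-out-of-gainers   ≡⟨ extra-out-of-gainers≡total-payout-increase ⟩
        total-payout-increase  <⟨ payout<gain ⟩
        total-gain             ∎)
      where open ≤-Reasoning

  gainers-partiallyPaidClosed : PartiallyPaidClosed a (λ w → a w < a′ w)
  gainers-partiallyPaidClosed u gain =
    search (any? (λ e → (src F e ≟ u) ×-dec (partially-paid? e (a u) ×-dec gains? (tgt F e))))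
           (any? (λ e → (src F e ≟ u) ×-dec partially-paid? e (a u)))
    where
    search : Dec (∃ λ e → src F e ≡ u × PartiallyPaid e (a u) × Gains (tgt F e)) →
             Dec (∃ λ e → src F e ≡ u × PartiallyPaid e (a u)) →
             ∃ λ e → src F e ≡ u × PartiallyPaid e (a u) × Gains (tgt F e)
    search (yes found) _ = found
    search (no none) (yes (e , se , pp)) = ⊥-elim (balance-is-tight (inj₁ (∑-mono-< m into≤out e strict)))
      where
      gain-src : Gains (src F e)
      gain-src = subst Gains (sym se) gain
      strict : if-dec (gains? (tgt F e)) (extra e) < if-dec (gains? (src F e)) (extra e)
      strict = subst₂ _<_ (sym (if-dec-no (gains? (tgt F e)) (λ gain′ → none (e , se , pp , gain′))))
                          (sym (if-dec-yes (gains? (src F e)) gain-src))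
                          (p<q⇒0<q-p (pay-strict e (subst (λ v → PartiallyPaid e (a v)) (sym se) pp) gain-src))
    search (no none) (no none′) = ⊥-elim (balance-is-tight (inj₂ (∑-mono-< n payout≤gain u strict)))
      where
      strict : if-dec (gains? u) (payout-increase u (a u) (a′ u)) < if-dec (gains? u) (a′ u - a u)
      strict = subst₂ _<_ (sym (if-dec-yes (gains? u) gain)) (sym (if-dec-yes (gains? u) gain))
                          (payout-increase-< wf u gain (λ e se pp → none′ (e , se , pp)))

module Orbit {n : ℕ} (f : Fin n → Fin n) (v : Fin n) where

  orbit : ℕ → Fin n
  orbit zero    = v
  orbit (suc s) = f (orbit s)

  -- visits s L w counts the times s ≤ i < s + L with orbit i ≡ w.
  visits : ℕ → ℕ → Fin n → ℚ
  visits s zero    w = 0ℚ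
  visits s (suc L) w = if-dec (orbit s ≟ w) 1ℚ + visits (suc s) L w

  visits-nonneg : ∀ s L w → 0ℚ ≤ visits s L w
  visits-nonneg s zero    w = ≤-refl
  visits-nonneg s (suc L) w =
    +-mono-≤ (if-dec-nonneg (orbit s ≟ w) (<⇒≤ (positive⁻¹ 1ℚ))) (visits-nonneg (suc s) L w)

  visits-closed : ∀ {P : Fin n → Set} → (∀ u → P u → P (f u)) → P v →
                  ∀ s L w → ¬ P w → visits s L w ≡ 0ℚ
  visits-closed {P} closed pv s zero    w ¬pw = refl
  visits-closed {P} closed pv s (suc L) w ¬pw =
    cong₂ _+_ (if-dec-no (orbit s ≟ w) (λ orbit≡w → ¬pw (subst P orbit≡w (on-orbit s))))
               (visits-closed closed pv (suc s) L w ¬pw)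
    where
    on-orbit : ∀ i → P (orbit i)
    on-orbit zero    = pv
    on-orbit (suc i) = closed (orbit i) (on-orbit i)

  visits-start : ∀ s L → 0ℚ < visits s (suc L) (orbit s)
  visits-start s L = subst (λ z → 0ℚ < z + visits (suc s) L (orbit s)) (sym (if-dec-yes (orbit s ≟ orbit s) refl))
    (+-mono-<-≤ (positive⁻¹ 1ℚ) (visits-nonneg (suc s) L (orbit s)))

  visits-snoc : ∀ s L w → visits s (suc L) w ≡ visits s L w + if-dec (orbit (s ℕ.+ L) ≟ w) 1ℚ
  visits-snoc s zero    w = trans (+-comm (if-dec (orbit s ≟ w) 1ℚ) 0ℚ)
                                  (cong (λ i → 0ℚ + if-dec (orbit i ≟ w) 1ℚ) (sym (ℕ.+-identityʳ s)))
  visits-snoc s (suc L) w = begin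
      if-dec (orbit s ≟ w) 1ℚ + visits (suc s) (suc L) w
    ≡⟨ cong (if-dec (orbit s ≟ w) 1ℚ +_) (visits-snoc (suc s) L w) ⟩
      if-dec (orbit s ≟ w) 1ℚ + (visits (suc s) L w + if-dec (orbit (suc s ℕ.+ L) ≟ w) 1ℚ)
    ≡⟨ sym (+-assoc (if-dec (orbit s ≟ w) 1ℚ) (visits (suc s) L w) _) ⟩
      visits s (suc L) w + if-dec (orbit (suc s ℕ.+ L) ≟ w) 1ℚ
    ≡⟨ cong (λ i → visits s (suc L) w + if-dec (orbit i ≟ w) 1ℚ) (sym (ℕ.+-suc s L)) ⟩
      visits s (suc L) w + if-dec (orbit (s ℕ.+ suc L) ≟ w) 1ℚ ∎
    where open ≡-Reasoning

  visits-periodic : ∀ s L w → orbit (s ℕ.+ L) ≡ orbit s → visits (suc s) L w ≡ visits s L w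
  visits-periodic s L w period = begin
      visits (suc s) L w
    ≡⟨ solve 2 (λ x y → y := (x :+ y) :- x) refl (if-dec (orbit s ≟ w) 1ℚ) (visits (suc s) L w) ⟩
      visits s (suc L) w - if-dec (orbit s ≟ w) 1ℚ
    ≡⟨ cong (_- if-dec (orbit s ≟ w) 1ℚ) (visits-snoc s L w) ⟩
      visits s L w + if-dec (orbit (s ℕ.+ L) ≟ w) 1ℚ - if-dec (orbit s ≟ w) 1ℚ
    ≡⟨ cong (λ x → visits s L w + x - if-dec (orbit s ≟ w) 1ℚ) (cong (λ u → if-dec (u ≟ w) 1ℚ) period) ⟩
      visits s L w + if-dec (orbit s ≟ w) 1ℚ - if-dec (orbit s ≟ w) 1ℚ
    ≡⟨ solve 2 (λ x y → x :+ y :- y := x) refl (visits s L w) (if-dec (orbit s ≟ w) 1ℚ) ⟩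
      visits s L w ∎
    where open ≡-Reasoning

  visits-pushforward : ∀ s L w → ∑ n (λ u → if-dec (f u ≟ w) (visits s L u)) ≡ visits (suc s) L w
  visits-pushforward s zero    w = ∑-zero n (λ u → if-dec-0 (f u ≟ w))
  visits-pushforward s (suc L) w = begin
      ∑ n (λ u → if-dec (f u ≟ w) (if-dec (orbit s ≟ u) 1ℚ + visits (suc s) L u))
    ≡⟨ ∑-cong n (λ u → if-dec-+ (f u ≟ w) _ _) ⟩
      ∑ n (λ u → if-dec (f u ≟ w) (if-dec (orbit s ≟ u) 1ℚ) + if-dec (f u ≟ w) (visits (suc s) L u))
    ≡⟨ ∑-distrib-+ n _ _ ⟩
      ∑ n (λ u → if-dec (f u ≟ w) (if-dec (orbit s ≟ u) 1ℚ)) + ∑ n (λ u → if-dec (f u ≟ w) (visits (suc s) L u))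
    ≡⟨ cong₂ _+_ (trans (∑-cong n (λ u → if-dec-comm (f u ≟ w) (orbit s ≟ u) 1ℚ))
                         (∑-δ n (orbit s) (λ u → if-dec (f u ≟ w) 1ℚ)))
                  (visits-pushforward (suc s) L w) ⟩
      if-dec (orbit (suc s) ≟ w) 1ℚ + visits (suc (suc s)) L w ∎
    where open ≡-Reasoning

record InvariantMeasure {n : ℕ} (f : Fin n → Fin n) (P : Fin n → Set) : Set where
  field
    weight     : Fin n → ℚ
    nonneg     : ∀ w → 0ℚ ≤ weight w
    supported  : ∀ w → ¬ P w → weight w ≡ 0ℚ
    invariant  : ∀ w → ∑ n (λ u → if-dec (f u ≟ w) (weight u)) ≡ weight w
    charged    : Fin n
    charged-pos : 0ℚ < weight charged

invariant-measure : ∀ {n} (f : Fin n → Fin n) {P : Fin n → Set} → (∀ u → P u → P (f u)) →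
                    ∀ {v} → P v → InvariantMeasure f P
invariant-measure {n} f {P} closed {v} pv = one-period (pigeonhole (ℕ.n<1+n n) (orbit ∘ toℕ))
  where
  open Orbit f v
  one-period : (∃₂ λ (i j : Fin (suc n)) → toℕ i ℕ.< toℕ j × orbit (toℕ i) ≡ orbit (toℕ j)) →
               InvariantMeasure f P
  one-period (i , j , i<j , same) = record
    { weight      = visits (toℕ i) (suc o)
    ; nonneg      = visits-nonneg (toℕ i) (suc o)
    ; supported   = visits-closed closed pv (toℕ i) (suc o)
    ; invariant   = λ w → trans (visits-pushforward (toℕ i) (suc o) w) (visits-periodic (toℕ i) (suc o) w period)
    ; charged     = orbit (toℕ i)
    ; charged-pos = visits-start (toℕ i) o
    }
    where
    o : ℕ
    o = proj₁ (ℕ.m≤n⇒∃[o]m+o≡n i<j)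
    period : orbit (toℕ i ℕ.+ suc o) ≡ orbit (toℕ i)
    period = trans (cong orbit (trans (ℕ.+-suc (toℕ i) o) (proj₂ (ℕ.m≤n⇒∃[o]m+o≡n i<j)))) (sym same)

scale-below : ∀ s k → 0ℚ < s → 0ℚ ≤ k → ∃ λ t → 0ℚ < t × t * k ≤ s
scale-below s k 0<s 0≤k = s * r , 0<t , t*k≤s
  where
  0<1+k : 0ℚ < 1ℚ + k
  0<1+k = +-mono-<-≤ (positive⁻¹ 1ℚ) 0≤k
  instance
    1+k≢0 : NonZero (1ℚ + k)
    1+k≢0 = pos⇒nonZero (1ℚ + k) {{positive 0<1+k}}
  r : ℚ
  r = 1/ (1ℚ + k)
  0<t : 0ℚ < s * r
  0<t = positive⁻¹ (s * r) {{pos*pos⇒pos s {{positive 0<s}} r {{1/pos⇒pos (1ℚ + k) {{positive 0<1+k}}}}}}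
  t*k≤s : s * r * k ≤ s
  t*k≤s = begin
      s * r * k
    ≤⟨ *-monoˡ-≤-nonNeg (s * r) {{nonNegative (<⇒≤ 0<t)}} k≤1+k ⟩
      s * r * (1ℚ + k)
    ≡⟨ trans (*-assoc s r _) (cong (s *_) (*-inverseˡ (1ℚ + k))) ⟩
      s * 1ℚ
    ≡⟨ *-identityʳ s ⟩
      s ∎
    where
    open ≤-Reasoning
    k≤1+k : k ≤ 1ℚ + k
    k≤1+k = subst (_≤ 1ℚ + k) (+-identityˡ k) (+-monoˡ-≤ k (<⇒≤ (positive⁻¹ 1ℚ)))

∃-uniform-scale : ∀ n (s k : Fin n → ℚ) → (∀ u → 0ℚ < s u) → (∀ u → 0ℚ ≤ k u) →
                  ∃ λ t → 0ℚ < t × ∀ u → t * k u ≤ s u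
∃-uniform-scale zero    s k 0<s 0≤k = 1ℚ , positive⁻¹ 1ℚ , λ ()
∃-uniform-scale (suc n) s k 0<s 0≤k =
  combine (scale-below (s zero) (k zero) (0<s zero) (0≤k zero))
          (∃-uniform-scale n (s ∘ suc) (k ∘ suc) (0<s ∘ suc) (0≤k ∘ suc))
  where
  combine : (∃ λ t → 0ℚ < t × t * k zero ≤ s zero) →
            (∃ λ t → 0ℚ < t × ∀ u → t * k (suc u) ≤ s (suc u)) →
            ∃ λ t → 0ℚ < t × ∀ u → t * k u ≤ s u
  combine (t₀ , 0<t₀ , t₀k≤s) (t′ , 0<t′ , t′k≤s) = t₀ ⊓ t′ , 0<t₀⊓t′ , bound
    where
    0<t₀⊓t′ : 0ℚ < t₀ ⊓ t′
    0<t₀⊓t′ with ⊓-sel t₀ t′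
    ... | inj₁ t₀⊓t′≡t₀ = subst (0ℚ <_) (sym t₀⊓t′≡t₀) 0<t₀
    ... | inj₂ t₀⊓t′≡t′ = subst (0ℚ <_) (sym t₀⊓t′≡t′) 0<t′
    bound : ∀ u → t₀ ⊓ t′ * k u ≤ s u
    shrink : ∀ {t} u → t₀ ⊓ t′ ≤ t → t₀ ⊓ t′ * k u ≤ t * k u
    shrink u = *-monoʳ-≤-nonNeg (k u) {{nonNegative (0≤k u)}}
    bound zero    = ≤-trans (shrink zero (p⊓q≤p t₀ t′)) t₀k≤s
    bound (suc u) = ≤-trans (shrink (suc u) (p⊓q≤q t₀ t′)) (t′k≤s u)

module Perturbation {n m : ℕ} {F : Network n m} (wf : WellFormed F)
  {a : Fin n → ℚ} (feasible : Feasible F a) {D : Fin n → Set} (D? : ∀ w → Dec (D w)) (closed : EdgeRanking.PartiallyPaidClosed F a D) where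

  open EdgeRanking F

  choose : ∀ u → Dec (D u) → Maybe (Fin m)
  choose u (yes du) = just (proj₁ (closed u du))
  choose u (no _)   = nothing

  chosen : Fin n → Maybe (Fin m)
  chosen u = choose u (D? u)

  data Chosen (u : Fin n) : Maybe (Fin m) → Set where
    outside : ¬ D u → Chosen u nothing
    partial : ∀ e → src F e ≡ u → PartiallyPaid e (a u) → D (tgt F e) → Chosen u (just e)

  chosen-spec : ∀ u → Chosen u (chosen u)
  chosen-spec u with D? u
  ... | yes du = let e , se , pp , dt = closed u du in partial e se pp dt
  ... | no ¬du = outside ¬du

  next-along : Fin n → Maybe (Fin m) → Fin n
  next-along u nothing  = u
  next-along u (just e) = tgt F e

  next : Fin n → Fin n
  next u = next-along u (chosen u)

  next-preserves : ∀ u → D u → D (next u)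
  next-preserves u du with chosen u | chosen-spec u
  ... | nothing | outside ¬du      = ⊥-elim (¬du du)
  ... | just e  | partial _ _ _ dt = dt

  -- Banks outside D carry no extra money; any positive bound would do for them.
  slack-along : Fin n → Maybe (Fin m) → ℚ
  slack-along u nothing  = 1ℚ
  slack-along u (just e) = before F e + ℓ e - a u

  slack : Fin n → ℚ
  slack u = slack-along u (chosen u)

  slack-pos : ∀ u → 0ℚ < slack u
  slack-pos u with chosen u | chosen-spec u
  ... | nothing | outside _                   = positive⁻¹ 1ℚ
  ... | just e  | partial _ refl (_ , a<b+ℓ) _ = p<q⇒0<q-p a<b+ℓ

  flow-along : Maybe (Fin m) → Fin m → ℚ → ℚ
  flow-along nothing   e x = 0ℚ
  flow-along (just e*) e x = if-dec (e* ≟ e) x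

  paid-into : (Fin n → ℚ) → Fin n → ℚ
  paid-into y v = ∑ m (λ e → if-dec (tgt F e ≟ v) (pay F e (y (src F e))))

  -- Every bank u sends t · μ(u) more along its chosen edge, which its slack leaves room for.
  module Shift (μ : InvariantMeasure next D) (t : ℚ) (0<t : 0ℚ < t)
               (tμ≤slack : ∀ u → t * InvariantMeasure.weight μ u ≤ slack u) where

    open InvariantMeasure μ renaming (weight to k)

    shifted : Fin n → ℚ
    shifted w = a w + t * k w

    tk-nonneg : ∀ u → 0ℚ ≤ t * k u
    tk-nonneg u = subst (_≤ t * k u) (*-zeroʳ t) (*-monoˡ-≤-nonNeg t {{nonNegative (<⇒≤ 0<t)}} (nonneg u))

    a≤shifted : ∀ u → a u ≤ shifted u
    a≤shifted u = subst (_≤ shifted u) (+-identityʳ (a u)) (+-monoʳ-≤ (a u) (tk-nonneg u))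

    a<shifted : a charged < shifted charged
    a<shifted = subst (_< shifted charged) (+-identityʳ (a charged)) (+-monoʳ-< (a charged)
      (subst (_< t * k charged) (*-zeroʳ t) (*-monoʳ-<-pos t {{positive 0<t}} charged-pos)))

    flow : Fin m → ℚ
    flow e = flow-along (chosen (src F e)) e (k (src F e))

    pay-shifted : ∀ e → pay F e (shifted (src F e)) ≡ pay F e (a (src F e)) + t * flow e
    pay-shifted e = along (chosen u) (chosen-spec u) (tμ≤slack u)
      where
      u : Fin n
      u = src F e
      unchanged : pay F e (shifted u) ≡ pay F e (a u) → pay F e (shifted u) ≡ pay F e (a u) + t * 0ℚ
      unchanged same = trans same (sym (trans (cong (pay F e (a u) +_) (*-zeroʳ t)) (+-identityʳ _)))
      along : ∀ c → Chosen u c → t * k u ≤ slack-along u c →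
              pay F e (shifted u) ≡ pay F e (a u) + t * flow-along c e (k u)
      along nothing (outside ¬du) _ = unchanged (cong (pay F e) shifted≡a)
        where
        shifted≡a : shifted u ≡ a u
        shifted≡a = trans (cong (λ z → a u + t * z) (supported u ¬du))
                          (trans (cong (a u +_) (*-zeroʳ t)) (+-identityʳ (a u)))
      along (just e*) (partial _ se* (b*≤a , a<b*+ℓ) _) tk≤ = along-edge (e* ≟ e)
        where
        shifted≤b*+ℓ : shifted u ≤ before F e* + ℓ e*
        shifted≤b*+ℓ = subst (shifted u ≤_) (solve 2 (λ x y → x :+ (y :- x) := y) refl (a u) (before F e* + ℓ e*))
                         (+-monoʳ-≤ (a u) tk≤)
        along-edge : (d : Dec (e* ≡ e)) → pay F e (shifted u) ≡ pay F e (a u) + t * if-dec d (k u)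
        along-edge (no e*≢e) = unchanged (pay-other wf se* e*≢e b*≤a shifted≤b*+ℓ (a≤shifted u))
        along-edge (yes refl) = begin
            pay F e (a u + t * k u)
          ≡⟨ pay-between e (≤-trans b*≤a (a≤shifted u)) shifted≤b*+ℓ ⟩
            a u + t * k u - before F e
          ≡⟨ solve 3 (λ x y z → x :+ y :- z := x :- z :+ y) refl (a u) (t * k u) (before F e) ⟩
            a u - before F e + t * k u
          ≡⟨ cong (_+ t * k u) (sym (pay-between e b*≤a (<⇒≤ a<b*+ℓ))) ⟩
            pay F e (a u) + t * k u ∎
          where open ≡-Reasoning

    flow-from : ∀ u w → ∑ m (λ e → if-dec (src F e ≟ u) (if-dec (tgt F e ≟ w) (flow-along (chosen u) e (k u))))
                      ≡ if-dec (next u ≟ w) (k u)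
    flow-from u w = along (chosen u) (chosen-spec u)
      where
      along : ∀ c → Chosen u c →
              ∑ m (λ e → if-dec (src F e ≟ u) (if-dec (tgt F e ≟ w) (flow-along c e (k u))))
              ≡ if-dec (next-along u c ≟ w) (k u)
      along nothing (outside ¬du) =
        trans (∑-zero m (λ e → trans (cong (if-dec (src F e ≟ u)) (if-dec-0 (tgt F e ≟ w))) (if-dec-0 (src F e ≟ u))))
              (sym (trans (cong (if-dec (u ≟ w)) (supported u ¬du)) (if-dec-0 (u ≟ w))))
      along (just e*) (partial _ se* _ _) = begin
          ∑ m (λ e → if-dec (src F e ≟ u) (if-dec (tgt F e ≟ w) (if-dec (e* ≟ e) (k u))))
        ≡⟨ ∑-cong m (λ e → trans (cong (if-dec (src F e ≟ u)) (if-dec-comm (tgt F e ≟ w) (e* ≟ e) (k u)))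
                                 (if-dec-comm (src F e ≟ u) (e* ≟ e) _)) ⟩
          ∑ m (λ e → if-dec (e* ≟ e) (if-dec (src F e ≟ u) (if-dec (tgt F e ≟ w) (k u))))
        ≡⟨ ∑-δ m e* _ ⟩
          if-dec (src F e* ≟ u) (if-dec (tgt F e* ≟ w) (k u))
        ≡⟨ if-dec-yes (src F e* ≟ u) se* ⟩
          if-dec (tgt F e* ≟ w) (k u) ∎
        where open ≡-Reasoning

    inflow : ∀ w → ∑ m (λ e → if-dec (tgt F e ≟ w) (flow e)) ≡ k w
    inflow w = begin
        ∑ m (λ e → if-dec (tgt F e ≟ w) (flow e))
      ≡⟨ ∑-partition n m (src F) _ ⟩
        ∑ n (λ u → ∑ m (λ e → if-dec (src F e ≟ u) (if-dec (tgt F e ≟ w) (flow e))))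
      ≡⟨ ∑-cong n (λ u → ∑-cong m (λ e → if-dec-cong (src F e ≟ u) λ { refl → refl })) ⟩
        ∑ n (λ u → ∑ m (λ e → if-dec (src F e ≟ u) (if-dec (tgt F e ≟ w) (flow-along (chosen u) e (k u)))))
      ≡⟨ ∑-cong n (λ u → flow-from u w) ⟩
        ∑ n (λ u → if-dec (next u ≟ w) (k u))
      ≡⟨ invariant w ⟩
        k w ∎
      where open ≡-Reasoning

    paid-into-shifted : ∀ v → paid-into shifted v ≡ paid-into a v + t * k v
    paid-into-shifted v = begin
        paid-into shifted v
      ≡⟨ ∑-cong m (λ e → trans (cong (if-dec (tgt F e ≟ v)) (pay-shifted e)) (if-dec-+ (tgt F e ≟ v) _ _)) ⟩
        ∑ m (λ e → if-dec (tgt F e ≟ v) (pay F e (a (src F e))) + if-dec (tgt F e ≟ v) (t * flow e))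
      ≡⟨ ∑-distrib-+ m _ _ ⟩
        paid-into a v + ∑ m (λ e → if-dec (tgt F e ≟ v) (t * flow e))
      ≡⟨ cong (paid-into a v +_) (∑-cong m (λ e → sym (*-if-dec (tgt F e ≟ v) t (flow e)))) ⟩
        paid-into a v + ∑ m (λ e → t * if-dec (tgt F e ≟ v) (flow e))
      ≡⟨ cong (paid-into a v +_) (sym (*-distribˡ-∑ m t _)) ⟩
        paid-into a v + t * ∑ m (λ e → if-dec (tgt F e ≟ v) (flow e))
      ≡⟨ cong (λ z → paid-into a v + t * z) (inflow v) ⟩
        paid-into a v + t * k v ∎
      where open ≡-Reasoning

    shifted-feasible : Feasible F shifted
    shifted-feasible = (λ v → +-mono-≤ (proj₁ feasible v) (tk-nonneg v)) , λ v → begin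
        a v + t * k v
      ≡⟨ cong (_+ t * k v) (proj₂ feasible v) ⟩
        toℚ (ext F v) + paid-into a v + t * k v
      ≡⟨ +-assoc (toℚ (ext F v)) _ _ ⟩
        toℚ (ext F v) + (paid-into a v + t * k v)
      ≡⟨ cong (toℚ (ext F v) +_) (sym (paid-into-shifted v)) ⟩
        toℚ (ext F v) + paid-into shifted v ∎
      where open ≡-Reasoning

partiallyPaidClosed⇒empty : ∀ {n m} {F : Network n m} → WellFormed F → ∀ {a} → Clearing F a →
  ∀ {D : Fin n → Set} → (∀ w → Dec (D w)) → EdgeRanking.PartiallyPaidClosed F a D → ∀ v → ¬ D v
partiallyPaidClosed⇒empty {n} wf (feasible , maximal) {D} D? closed v dv =
  <-irrefl refl (<-≤-trans a<shifted (maximal shifted shifted-feasible charged))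
  where
  open Perturbation wf feasible D? closed
  μ : InvariantMeasure next D
  μ = invariant-measure next next-preserves dv
  open InvariantMeasure μ using (weight; nonneg; charged)
  scale : ∃ λ t → 0ℚ < t × ∀ u → t * weight u ≤ slack u
  scale = ∃-uniform-scale n slack weight slack-pos nonneg
  open Shift μ (proj₁ scale) (proj₁ (proj₂ scale)) (proj₂ (proj₂ scale))

-- The argument only needs that both creditors gain.
theorem1 : ∀ {n m : ℕ} (F : Network n m) → WellFormed F →
    (e1 e2 : Fin m) →
    liab F e1 ≡ liab F e2 →
    src F e1 ≢ tgt F e1 → src F e1 ≢ src F e2 → src F e1 ≢ tgt F e2 →
    tgt F e1 ≢ src F e2 → tgt F e1 ≢ tgt F e2 → src F e2 ≢ tgt F e2 →
    (a aσ : Fin n → ℚ) → Clearing F a → Clearing (swap F e1 e2) aσ →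
    ¬ ((a (tgt F e1) < aσ (tgt F e1)) × (a (tgt F e2) < aσ (tgt F e2)))
theorem1 F wf e1 e2 _ _ _ _ _ _ _ a aσ clearing (feasibleσ , _) (gain₁ , gain₂) =
  partiallyPaidClosed⇒empty wf clearing (λ w → a w <? aσ w)
    (gainers-partiallyPaidClosed F wf (tgt (swap F e1 e2)) (proj₁ clearing) feasibleσ same-gain)
    (tgt F e1) gain₁
  where
  same-gain : ∀ e → (a (tgt F e) < aσ (tgt F e)) ⇔ (a (tgt (swap F e1 e2) e) < aσ (tgt (swap F e1 e2) e))
  same-gain e with e ≟ e1 | e ≟ e2
  ... | yes refl | _        = mk⇔ (λ _ → gain₂) (λ _ → gain₁)
  ... | no _     | yes refl = mk⇔ (λ _ → gain₁) (λ _ → gain₂)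
  ... | no _     | no _     = mk⇔ (λ g → g) (λ g → g)
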